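{- Let $\Gamma$ be a finite simple graph whose edges are each colored red, green or blue. Let $S$ be the set of ordered tuples $(u,v,x,y) \in V(\Gamma)^4$ such that $uv$ is a red edge, $ux$ and $uy$ are blue edges, and $vx$ and $vy$ are green edges (with $x = y$ allowed). Let $S'$ be the set of ordered pairs $(g,b)$ where $g$ is a green edge and $b$ is a blue edge of $\Gamma$ (edges regarded as unordered). Then $|S| \le |S'|$. -}

module Defs where

open import Data.Nat using (ℕ; _<_)
open import Data.Fin using (Fin; toℕ)
open import Data.Fin.Properties using (_≟_)
open import Data.List using (List; length; filter; allFin; cartesianProduct)
open import Data.Maybe using (Maybe; just; nothing)
open import Data.Product using (_×_; _,_)
open import Relation.Binary.PropositionalEquality using (_≡_)
open import Relation.Nullary using (Dec; yes; no)
open import Relation.Nullary.Decidable using (_×-dec_)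

data Colour : Set where
  red green blue : Colour

_≟ᶜ_ : (a b : Colour) → Dec (a ≡ b)
red ≟ᶜ red = yes _≡_.refl
red ≟ᶜ green = no λ ()
red ≟ᶜ blue = no λ ()
green ≟ᶜ red = no λ ()
green ≟ᶜ green = yes _≡_.refl
green ≟ᶜ blue = no λ ()
blue ≟ᶜ red = no λ ()
blue ≟ᶜ green = no λ ()
blue ≟ᶜ blue = yes _≡_.refl

-- A finite simple graph on vertex set Fin n with each edge coloured red,
-- green or blue: col i j = just c iff ij is an edge of colour c,
-- col i j = nothing iff ij is not an edge.
record ColouredGraph (n : ℕ) : Set where
  field
    col       : Fin n → Fin n → Maybe Colour
    loopless  : ∀ i → col i i ≡ nothing
    symmetric : ∀ i j → col i j ≡ col j i
open ColouredGraph public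

IsEdge : ∀ {n} → ColouredGraph n → Colour → Fin n → Fin n → Set
IsEdge G c i j = col G i j ≡ just c

isEdge? : ∀ {n} (G : ColouredGraph n) (c : Colour) (i j : Fin n) → Dec (IsEdge G c i j)
isEdge? G c i j with col G i j
... | nothing = no λ ()
... | just d with d ≟ᶜ c
...   | yes _≡_.refl = yes _≡_.refl
...   | no d≢c = no λ { _≡_.refl → d≢c _≡_.refl }

pairs : ∀ n → List (Fin n × Fin n)
pairs n = cartesianProduct (allFin n) (allFin n)

quads : ∀ n → List ((Fin n × Fin n) × (Fin n × Fin n))
quads n = cartesianProduct (pairs n) (pairs n)

InS : ∀ {n} → ColouredGraph n → (Fin n × Fin n) × (Fin n × Fin n) → Set
InS G ((u , v) , (x , y)) =
  IsEdge G red u v × (IsEdge G blue u x × IsEdge G blue u y) ×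
  (IsEdge G green v x × IsEdge G green v y)

inS? : ∀ {n} (G : ColouredGraph n) t → Dec (InS G t)
inS? G ((u , v) , (x , y)) =
  isEdge? G red u v ×-dec (isEdge? G blue u x ×-dec isEdge? G blue u y) ×-dec
  (isEdge? G green v x ×-dec isEdge? G green v y)

cardS : ∀ {n} → ColouredGraph n → ℕ
cardS {n} G = length (filter (inS? G) (quads n))

-- Unordered edges of colour c, each represented once as (i , j) with i < j.
EdgeRep : ∀ {n} → ColouredGraph n → Colour → Fin n × Fin n → Set
EdgeRep G c (i , j) = (toℕ i < toℕ j) × IsEdge G c i j

edgeRep? : ∀ {n} (G : ColouredGraph n) c p → Dec (EdgeRep G c p)
edgeRep? G c (i , j) = (toℕ i Data.Nat.<? toℕ j) ×-dec isEdge? G c i j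

edges : ∀ {n} → ColouredGraph n → Colour → List (Fin n × Fin n)
edges {n} G c = filter (edgeRep? G c) (pairs n)

S' : ∀ {n} → ColouredGraph n → List ((Fin n × Fin n) × (Fin n × Fin n))
S' G = cartesianProduct (edges G green) (edges G blue)

cardS' : ∀ {n} → ColouredGraph n → ℕ
cardS' G = length (S' G)

-- The map (u , v , x , y) ↦ (vx , uy) sends S into S′, vx being green and uy blue.
-- It is injective on S: the endpoints of the two unordered edges can be matched to the
-- roles u, v, x, y in only one way, because any other matching would give some pair of
-- vertices two different colours.
module Submission where

open import Defs
open import Data.Nat using (ℕ; suc; _≤_; z≤n; s≤s; _<?_)
open import Data.Nat.Properties using (≮⇒≥; ≤∧≢⇒<; module ≤-Reasoning)
open import Data.Fin using (Fin; toℕ)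
open import Data.Fin.Properties using (toℕ-injective)
open import Data.List using (List; []; _∷_; length; filter)
open import Data.List.Properties using (length-removeAt′)
open import Data.List.Membership.Propositional using (_∈_)
open import Data.List.Membership.Propositional.Properties
  using (∈-filter⁺; ∈-filter⁻; ∈-cartesianProduct⁺; ∈-allFin)
open import Data.List.Relation.Unary.Any using (here; there; index; _─_)
open import Data.List.Relation.Unary.All using (lookup)
open import Data.List.Relation.Unary.AllPairs using (_∷_)
open import Data.List.Relation.Unary.Unique.Propositional using (Unique)
import Data.List.Relation.Unary.Unique.Propositional.Properties as Unique
open import Data.Product using (_×_; _,_; proj₁; proj₂; swap)
open import Data.Product.Properties using (,-injective)
open import Data.Sum using (_⊎_; inj₁; inj₂)
open import Relation.Nullary using (yes; no; contradiction)
open import Relation.Binary.PropositionalEquality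
  using (_≡_; _≢_; refl; sym; trans; cong)

private
  variable
    A B : Set

∈-─ : ∀ {x y : A} {ys : List A} (y∈ys : y ∈ ys) → x ∈ ys → x ≢ y → x ∈ (ys ─ y∈ys)
∈-─ (here refl) (here refl) x≢y = contradiction refl x≢y
∈-─ (here refl) (there x∈ys) _  = x∈ys
∈-─ (there _)   (here refl)  _  = here refl
∈-─ (there y∈ys) (there x∈ys) x≢y = there (∈-─ y∈ys x∈ys x≢y)

length-≤-injectiveOn : (f : A → B) {xs : List A} {ys : List B} → Unique xs →
  (∀ {x} → x ∈ xs → f x ∈ ys) →
  (∀ {x x′} → x ∈ xs → x′ ∈ xs → f x ≡ f x′ → x ≡ x′) →
  length xs ≤ length ys
length-≤-injectiveOn f {[]}     _ _ _ = z≤n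
length-≤-injectiveOn f {x ∷ xs} {ys} (x∉xs ∷ xs!) maps inj = begin
  suc (length xs)           ≤⟨ s≤s (length-≤-injectiveOn f xs! maps′ inj′) ⟩
  suc (length (ys ─ fx∈ys)) ≡⟨ sym (length-removeAt′ ys (index fx∈ys)) ⟩
  length ys                 ∎
  where
  open ≤-Reasoning
  fx∈ys : f x ∈ ys
  fx∈ys = maps (here refl)
  inj′ : ∀ {x′ x″} → x′ ∈ xs → x″ ∈ xs → f x′ ≡ f x″ → x′ ≡ x″
  inj′ p q = inj (there p) (there q)
  maps′ : ∀ {x′} → x′ ∈ xs → f x′ ∈ (ys ─ fx∈ys)
  maps′ x′∈xs = ∈-─ fx∈ys (maps (there x′∈xs))
    (λ fx′≡fx → lookup x∉xs x′∈xs (sym (inj (there x′∈xs) (here refl) fx′≡fx)))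

sortPair : ∀ {n} → Fin n → Fin n → Fin n × Fin n
sortPair i j with toℕ i <? toℕ j
... | yes _ = (i , j)
... | no _  = (j , i)

sortPair-cases : ∀ {n} (i j : Fin n) → sortPair i j ≡ (i , j) ⊎ sortPair i j ≡ (j , i)
sortPair-cases i j with toℕ i <? toℕ j
... | yes _ = inj₁ refl
... | no _  = inj₂ refl

sortPair-injective : ∀ {n} {a b c d : Fin n} → sortPair a b ≡ sortPair c d →
  (a ≡ c × b ≡ d) ⊎ (a ≡ d × b ≡ c)
sortPair-injective {a = a} {b} {c} {d} e with sortPair-cases a b | sortPair-cases c d
... | inj₁ p | inj₁ q = inj₁ (,-injective (trans (sym p) (trans e q)))
... | inj₁ p | inj₂ q = inj₂ (,-injective (trans (sym p) (trans e q)))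
... | inj₂ p | inj₁ q = inj₂ (swap (,-injective (trans (sym p) (trans e q))))
... | inj₂ p | inj₂ q = inj₁ (swap (,-injective (trans (sym p) (trans e q))))

Quad : ℕ → Set
Quad n = (Fin n × Fin n) × (Fin n × Fin n)

greenBlue : ∀ {n} → Quad n → Quad n
greenBlue ((u , v) , (x , y)) = (sortPair v x , sortPair u y)

module _ {n} (G : ColouredGraph n) where

  IsEdge-sym : ∀ {c i j} → IsEdge G c i j → IsEdge G c j i
  IsEdge-sym {i = i} {j} e = trans (symmetric G j i) e

  IsEdge-irrefl : ∀ {c i j} → IsEdge G c i j → i ≢ j
  IsEdge-irrefl {i = i} e refl with trans (sym (loopless G i)) e
  ... | ()

  colour-unique : ∀ {c d i j} → IsEdge G c i j → IsEdge G d i j → c ≡ d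
  colour-unique p q with trans (sym p) q
  ... | refl = refl

  sortPair∈edges : ∀ {c i j} → IsEdge G c i j → sortPair i j ∈ edges G c
  sortPair∈edges {c} {i} {j} e with toℕ i <? toℕ j
  ... | yes i<j = ∈-filter⁺ (edgeRep? G c)
    (∈-cartesianProduct⁺ (∈-allFin i) (∈-allFin j)) (i<j , e)
  ... | no i≮j  = ∈-filter⁺ (edgeRep? G c)
    (∈-cartesianProduct⁺ (∈-allFin j) (∈-allFin i))
    (≤∧≢⇒< (≮⇒≥ i≮j) (λ j≡i → IsEdge-irrefl e (toℕ-injective (sym j≡i)))
    , IsEdge-sym e)

  greenBlue∈S' : ∀ {t} → InS G t → greenBlue t ∈ S' G
  greenBlue∈S' (_ , (_ , uy) , (vx , _)) =
    ∈-cartesianProduct⁺ (sortPair∈edges vx) (sortPair∈edges uy)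

  greenBlue-injectiveOn : ∀ {s t} → InS G s → InS G t → greenBlue s ≡ greenBlue t → s ≡ t
  greenBlue-injectiveOn (uv , (ux , _) , (_ , vy)) (uv′ , (ux′ , _) , (_ , vy′)) e
    with sortPair-injective (cong proj₁ e) | sortPair-injective (cong proj₂ e)
  ... | inj₁ (refl , refl) | inj₁ (refl , refl) = refl
  ... | inj₁ (refl , refl) | inj₂ (refl , refl) =
    contradiction (colour-unique uv′ (IsEdge-sym vy)) λ ()
  ... | inj₂ (refl , refl) | inj₁ (refl , refl) =
    contradiction (colour-unique uv ux′) λ ()
  ... | inj₂ (refl , refl) | inj₂ (refl , refl) =
    contradiction (colour-unique ux (IsEdge-sym vy′)) λ ()

lemma2p3 : (n : ℕ) (G : ColouredGraph n) → cardS G ≤ cardS' G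
lemma2p3 n G = length-≤-injectiveOn greenBlue
  (Unique.filter⁺ (inS? G) (Unique.cartesianProduct⁺ pairs! pairs!))
  (λ t∈S → greenBlue∈S' G (inS t∈S))
  (λ s∈S t∈S → greenBlue-injectiveOn G (inS s∈S) (inS t∈S))
  where
  pairs! : Unique (pairs n)
  pairs! = Unique.cartesianProduct⁺ (Unique.allFin⁺ n) (Unique.allFin⁺ n)
  inS : ∀ {t} → t ∈ filter (inS? G) (quads n) → InS G t
  inS t∈S = proj₂ (∈-filter⁻ (inS? G) {xs = quads n} t∈S)
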